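{- Let $P$ be a lattice $3$-polytope boxed with respect to the unit cube $Q=[0,1]^3$ such that $\mathrm{conv}(P\cap Q\cap\mathbb{Z}^3)$ is a facet of $Q$. Write $(P\cap\mathbb{Z}^3)\setminus Q=\{v_1,v_2,v_3\}$, where $v_i$ has $i$-th coordinate $a_i\in\mathbb{Z}\setminus\{0,1\}$ and its other two coordinates in $\{0,1\}$, and let $d_i:=\max\{a_i-1,-a_i\}$. Then $d_i\le6$ for all $i\in\{1,2,3\}$.
   Context: An affine functional $f$ is integer if $f(\mathbb{Z}^3)\subseteq\mathbb{Z}$. Width of $P$: minimum over non-constant integer affine $f$ of $\max_P f-\min_P f$. A lattice $3$-polytope $P$ of width larger than one is boxed with respect to $[0,1]^3=\bigcap_i f_i^{ -1}([0,1])$, with $f_1=x,f_2=y,f_3=z$, if $(P\cap\mathbb{Z}^3)\setminus[0,1]^3=\{v_1,v_2,v_3\}$ with $f_i(v_j)\notin\{0,1\}$ if and only if $i=j$. -}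

module Defs where

open import Data.Nat using (ℕ)
open import Data.Integer as ℤ using (ℤ; +_; _-_; -_)
open import Data.Rational as ℚ using (ℚ; 0ℚ; 1ℚ)
open import Data.Fin using (Fin)
open import Data.Vec using (Vec; lookup)
open import Data.List using (List; []; _∷_; length; zipWith)
open import Data.List.Membership.Propositional using (_∈_)
open import Data.Product using (Σ; ∃; _×_; _,_)
open import Data.Sum using (_⊎_)
open import Relation.Nullary using (¬_)
open import Relation.Binary.PropositionalEquality using (_≡_)
open import Function.Bundles using (_⇔_)

Point : Set
Point = Vec ℤ 3

coord : Point → Fin 3 → ℤ
coord p i = lookup p i

toℚ : ℤ → ℚ
toℚ z = z ℚ./ 1

sumℚ : List ℚ → ℚ
sumℚ [] = 0ℚ
sumℚ (q ∷ qs) = q ℚ.+ sumℚ qs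

-- A lattice polytope P = conv(V) is given by a finite list V of lattice points.
-- A point p with rational coordinates (here: a lattice point) lies in conv(V)
-- iff it is a convex combination of V with rational coefficients
-- (for rational points, real and rational convex combinations agree).
InConv : List Point → Point → Set
InConv V p =
  Σ (List ℚ) λ λs →
    (length λs ≡ length V) ×
    ((q : ℚ) → q ∈ λs → 0ℚ ℚ.≤ q) ×
    (sumℚ λs ≡ 1ℚ) ×
    ((k : Fin 3) → sumℚ (zipWith (λ l v → l ℚ.* toℚ (coord v k)) λs V) ≡ toℚ (coord p k))

-- integer affine functional x ↦ c·x (+ constant, irrelevant for widths)
lin : Point → Point → ℤ
lin c x = coord c Fin0 ℤ.* coord x Fin0 ℤ.+ coord c Fin1 ℤ.* coord x Fin1 ℤ.+ coord c Fin2 ℤ.* coord x Fin2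
  where
    open import Data.Fin using (zero; suc)
    Fin0 Fin1 Fin2 : Fin 3
    Fin0 = zero
    Fin1 = suc zero
    Fin2 = suc (suc zero)

-- width of conv(V) is larger than one: every non-constant integer affine
-- functional has max − min over conv(V) (attained at points of V) at least 2.
WidthGt1 : List Point → Set
WidthGt1 V =
  (c : Point) → ¬ ((k : Fin 3) → coord c k ≡ + 0) →
  Σ Point λ u → Σ Point λ w → (u ∈ V) × (w ∈ V) × (+ 2 ℤ.≤ lin c u - lin c w)

IsBit : ℤ → Set
IsBit z = (z ≡ + 0) ⊎ (z ≡ + 1)

InCube : Point → Set
InCube p = (k : Fin 3) → IsBit (coord p k)

-- conv(V) is boxed w.r.t. [0,1]³ with (P ∩ ℤ³) ∖ [0,1]³ = {v 0, v 1, v 2}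
Boxed : List Point → (Fin 3 → Point) → Set
Boxed V v =
  WidthGt1 V ×
  ((j : Fin 3) → InConv V (v j)) ×
  ((j : Fin 3) → ¬ InCube (v j)) ×
  ((p : Point) → InConv V p → ¬ InCube p → ∃ λ j → p ≡ v j) ×
  ((i j : Fin 3) → ((¬ IsBit (coord (v j) i)) ⇔ (i ≡ j)))

-- conv(P ∩ Q ∩ ℤ³) is a facet of Q = [0,1]³: the lattice points of P in Q are
-- exactly the four vertices of a facet {x_i = b}, b ∈ {0,1}.
FacetCond : List Point → Set
FacetCond V =
  Σ (Fin 3) λ i → Σ ℤ λ b → IsBit b ×
    ((p : Point) → InCube p → (InConv V p ⇔ (coord p i ≡ b)))

dval : ℤ → ℤ
dval a = (a - + 1) ℤ.⊔ (- a)

-- A signed permutation of the coordinates is a symmetry of the unit cube;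
-- acting on the vertex list it preserves every hypothesis and the values d_i, so the
-- facet may be taken to be the floor z = 0.  The z-vertex then has height -1: otherwise
-- the segment joining it to the floor contains a lattice point (s, t, ±1) that is not
-- allowed.  For the x-vertex (a, s₁, t₁) it suffices to refute a ≥ 8 (the bound a ≥ -6 and
-- the y-vertex follow from x ↦ 1 - x and x ↔ y), and after y ↦ 1 - y the z-vertex is
-- (s₃, 0, -1).  A lattice point (n, y, z) of P with 2 ≤ n < 8 is then impossible, and
-- convex combinations produce one: on the segment from (1, s₁, 0) to the x-vertex if
-- t₁ = 0; otherwise (4, s₁/2, 0) lies between (0, s₁/2, 0) and the midpoint of the x- and
-- z-vertex, which settles s₁ = 0.  For s₁ = 1 the y-vertex gives a floor point
-- (w, 3/2, 0) or (w, -1/2, 0) with 0 ≤ w ≤ 1, whose hull with (4, 1/2, 0) and the floor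
-- square contains (2, 1, 0) or (2, 0, 0) -- unless the y-vertex is (s₂, 2, 1), in which
-- case every lattice point of P has z - y ∈ {-1, 0}, against width > 1.  Convex
-- combinations are computed with integer points of the dilations d · conv V.

module Submission where

open import Defs
open import Data.Fin using (Fin)
open import Data.List using (List)
open import Data.Integer using (+_; _≤_)

open import Data.Bool using (Bool; true; false)
open import Data.Empty using (⊥; ⊥-elim)
open import Data.Fin using (_≟_)
open import Data.Fin.Patterns using (0F; 1F; 2F)
open import Data.Fin.Permutation as Perm using (Permutation′; _⟨$⟩ʳ_; _⟨$⟩ˡ_)
open import Data.Fin.Properties using (all?)
open import Data.Integer as ℤ using (ℤ; -[1+_]; -_; +≤+; -≤-; -≤+)
import Data.Integer.Properties as ℤP
open import Data.Integer.Tactic.RingSolver using (solve-∀)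
open import Algebra.Properties.CommutativeMonoid.Sum ℤP.+-0-commutativeMonoid using (sum; sum-cong-≗; sum-permute)
open import Data.List using ([]; _∷_; length; map; replicate; zipWith)
open import Data.List.Membership.Propositional using (_∈_)
open import Data.List.Membership.Propositional.Properties using (∈-map⁺)
open import Data.List.Properties using (length-map; length-replicate; length-zipWith; map-∘; map-cong; map-id)
open import Data.List.Relation.Unary.All as All using (All; []; _∷_)
open import Data.List.Relation.Unary.All.Properties using (map⁺)
open import Data.List.Relation.Unary.Any using (here; there)
open import Data.Nat as ℕ using (ℕ; zero; suc; z≤n; s≤s)
import Data.Nat.Properties as ℕP
import Data.Nat.Tactic.RingSolver as ℕ-Solver
open import Data.Product using (Σ; ∃; _×_; _,_; proj₁; proj₂)
open import Data.Rational as ℚ using (ℚ; 0ℚ; 1ℚ; toℚᵘ)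
import Data.Rational.Properties as ℚP
open import Data.Rational.Solver using (module +-*-Solver)
open import Data.Rational.Unnormalised as ℚᵘ using (mkℚᵘ; *≡*)
import Data.Rational.Unnormalised.Properties as ℚᵘP
open import Data.Sum using (_⊎_; inj₁; inj₂)
open import Data.Vec as Vec using (_∷_; []; tabulate; _[_]≔_)
open import Data.Vec.Properties
  using (lookup-map; lookup-zipWith; lookup∘tabulate; lookup∘update; lookup∘update′; tabulate∘lookup; tabulate-cong)
open import Function using (_∘_; _$_; case_of_)
open import Function.Bundles using (_⇔_; mk⇔; Equivalence)
open import Relation.Binary.PropositionalEquality
open import Relation.Nullary using (¬_; Dec; yes; no; does)
open import Relation.Nullary.Decidable using (_⊎-dec_; decidable-stable)

open +-*-Solver using (solve; _:=_; _:+_; _:*_; _:-_; con)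

toℚᵘ-toℚ : ∀ a → toℚᵘ (toℚ a) ℚᵘ.≃ mkℚᵘ a 0
toℚᵘ-toℚ a = ℚP.toℚᵘ-fromℚᵘ (mkℚᵘ a 0)

toℚ-+ : ∀ a b → toℚ (a ℤ.+ b) ≡ toℚ a ℚ.+ toℚ b
toℚ-+ a b = ℚP.toℚᵘ-injective (begin
  toℚᵘ (toℚ (a ℤ.+ b))             ≈⟨ toℚᵘ-toℚ (a ℤ.+ b) ⟩
  mkℚᵘ (a ℤ.+ b) 0                 ≈⟨ *≡* (expand a b) ⟩
  mkℚᵘ a 0 ℚᵘ.+ mkℚᵘ b 0           ≈⟨ ℚᵘP.+-cong (toℚᵘ-toℚ a) (toℚᵘ-toℚ b) ⟨
  toℚᵘ (toℚ a) ℚᵘ.+ toℚᵘ (toℚ b)   ≈⟨ ℚP.toℚᵘ-homo-+ (toℚ a) (toℚ b) ⟨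
  toℚᵘ (toℚ a ℚ.+ toℚ b)           ∎)
  where
    open ℚᵘP.≃-Reasoning
    expand : ∀ a b → (a ℤ.+ b) ℤ.* + 1 ≡ (a ℤ.* + 1 ℤ.+ b ℤ.* + 1) ℤ.* + 1
    expand = solve-∀

toℚ-* : ∀ a b → toℚ (a ℤ.* b) ≡ toℚ a ℚ.* toℚ b
toℚ-* a b = ℚP.toℚᵘ-injective (begin
  toℚᵘ (toℚ (a ℤ.* b))             ≈⟨ toℚᵘ-toℚ (a ℤ.* b) ⟩
  mkℚᵘ a 0 ℚᵘ.* mkℚᵘ b 0           ≈⟨ ℚᵘP.*-cong (toℚᵘ-toℚ a) (toℚᵘ-toℚ b) ⟨
  toℚᵘ (toℚ a) ℚᵘ.* toℚᵘ (toℚ b)   ≈⟨ ℚP.toℚᵘ-homo-* (toℚ a) (toℚ b) ⟨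
  toℚᵘ (toℚ a ℚ.* toℚ b)           ∎)
  where open ℚᵘP.≃-Reasoning

toℚ-neg : ∀ a → toℚ (- a) ≡ ℚ.- toℚ a
toℚ-neg a = ℚP.toℚᵘ-injective (begin
  toℚᵘ (toℚ (- a))                 ≈⟨ toℚᵘ-toℚ (- a) ⟩
  mkℚᵘ (- a) 0                     ≈⟨ ℚᵘP.-‿cong (toℚᵘ-toℚ a) ⟨
  ℚᵘ.- toℚᵘ (toℚ a)                ≈⟨ ℚP.toℚᵘ-homo‿- (toℚ a) ⟨
  toℚᵘ (ℚ.- toℚ a)                 ∎)
  where open ℚᵘP.≃-Reasoning

isBit? : ∀ x → Dec (IsBit x)
isBit? x = (x ℤ.≟ + 0) ⊎-dec (x ℤ.≟ + 1)

IsBit⇒nonNeg : ∀ {x} → IsBit x → + 0 ℤ.≤ x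
IsBit⇒nonNeg (inj₁ refl) = +≤+ z≤n
IsBit⇒nonNeg (inj₂ refl) = +≤+ z≤n

point-η : ∀ (p : Point) → p ≡ coord p 0F ∷ coord p 1F ∷ coord p 2F ∷ []
point-η (x ∷ y ∷ z ∷ []) = refl

infixl 6 _⊕_
infixr 7 _⊛_

_⊕_ : Point → Point → Point
p ⊕ q = Vec.zipWith ℤ._+_ p q

_⊛_ : ℕ → Point → Point
k ⊛ p = Vec.map (+ k ℤ.*_) p

point-ext : ∀ {p q : Point} → (∀ k → coord p k ≡ coord q k) → p ≡ q
point-ext {p} {q} p≗q = trans (sym (tabulate∘lookup p)) (trans (tabulate-cong p≗q) (tabulate∘lookup q))

coord-combination : ∀ m j (p q : Point) k → coord (m ⊛ p ⊕ j ⊛ q) k ≡ + m ℤ.* coord p k ℤ.+ + j ℤ.* coord q k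
coord-combination m j p q k =
  trans (lookup-zipWith ℤ._+_ k (m ⊛ p) (j ⊛ q)) (cong₂ ℤ._+_ (lookup-map k (+ m ℤ.*_) p) (lookup-map k (+ j ℤ.*_) q))

≤⇒offset : ∀ {x z} → x ℤ.≤ z → Σ ℕ λ j → z ≡ x ℤ.+ + j
≤⇒offset {x} {z} x≤z = ℤ.∣ z ℤ.- x ∣ , (begin
  z                          ≡⟨ cancel z x ⟨
  x ℤ.+ (z ℤ.- x)            ≡⟨ cong (λ t → x ℤ.+ t) (ℤP.0≤i⇒+∣i∣≡i (ℤP.i≤j⇒0≤j-i x≤z)) ⟨
  x ℤ.+ + ℤ.∣ z ℤ.- x ∣      ∎)
  where
    open ≡-Reasoning
    cancel : ∀ z x → x ℤ.+ (z ℤ.- x) ≡ z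
    cancel = solve-∀

-- Cones and dilations of conv V

weighted : List ℚ → List Point → (Point → ℚ) → ℚ
weighted μs V f = sumℚ (zipWith (λ μ v → μ ℚ.* f v) μs V)

weighted-cong : ∀ μs V {f g : Point → ℚ} → (∀ v → f v ≡ g v) → weighted μs V f ≡ weighted μs V g
weighted-cong []       V       f≗g = refl
weighted-cong (μ ∷ μs) []      f≗g = refl
weighted-cong (μ ∷ μs) (v ∷ V) f≗g = cong₂ (λ x y → μ ℚ.* x ℚ.+ y) (f≗g v) (weighted-cong μs V f≗g)

weighted-map : ∀ μs V (g : Point → Point) f → weighted μs (map g V) f ≡ weighted μs V (f ∘ g)
weighted-map []       V       g f = refl
weighted-map (μ ∷ μs) []      g f = refl
weighted-map (μ ∷ μs) (v ∷ V) g f = cong (μ ℚ.* f (g v) ℚ.+_) (weighted-map μs V g f)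

weighted-+ : ∀ μs νs V f → length μs ≡ length V → length νs ≡ length V →
             weighted (zipWith ℚ._+_ μs νs) V f ≡ weighted μs V f ℚ.+ weighted νs V f
weighted-+ []       []       []      f _  _  = ℚP.+-identityʳ 0ℚ
weighted-+ (μ ∷ μs) (ν ∷ νs) (v ∷ V) f eμ eν =
  trans (cong ((μ ℚ.+ ν) ℚ.* f v ℚ.+_) (weighted-+ μs νs V f (ℕP.suc-injective eμ) (ℕP.suc-injective eν)))
        (solve 5 (λ μ ν x s t → (μ :+ ν) :* x :+ (s :+ t) := (μ :* x :+ s) :+ (ν :* x :+ t)) refl
               μ ν (f v) (weighted μs V f) (weighted νs V f))

weighted-* : ∀ c μs V f → weighted (map (c ℚ.*_) μs) V f ≡ c ℚ.* weighted μs V f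
weighted-* c []       V       f = sym (ℚP.*-zeroʳ c)
weighted-* c (μ ∷ μs) []      f = sym (ℚP.*-zeroʳ c)
weighted-* c (μ ∷ μs) (v ∷ V) f =
  trans (cong (c ℚ.* μ ℚ.* f v ℚ.+_) (weighted-* c μs V f))
        (solve 4 (λ c μ x s → c :* μ :* x :+ c :* s := c :* (μ :* x :+ s)) refl c μ (f v) (weighted μs V f))

weighted-1- : ∀ μs V f → length μs ≡ length V →
              weighted μs V (λ v → 1ℚ ℚ.- f v) ≡ sumℚ μs ℚ.- weighted μs V f
weighted-1- []       []      f _ = refl
weighted-1- (μ ∷ μs) (v ∷ V) f e =
  trans (cong (μ ℚ.* (1ℚ ℚ.- f v) ℚ.+_) (weighted-1- μs V f (ℕP.suc-injective e)))
        (solve 4 (λ μ x s t → μ :* (con 1ℚ :- x) :+ (s :- t) := μ :+ s :- (μ :* x :+ t)) refl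
               μ (f v) (sumℚ μs) (weighted μs V f))

sumℚ-+ : ∀ μs νs → length μs ≡ length νs → sumℚ (zipWith ℚ._+_ μs νs) ≡ sumℚ μs ℚ.+ sumℚ νs
sumℚ-+ []       []       _ = ℚP.+-identityʳ 0ℚ
sumℚ-+ (μ ∷ μs) (ν ∷ νs) e =
  trans (cong (μ ℚ.+ ν ℚ.+_) (sumℚ-+ μs νs (ℕP.suc-injective e)))
        (solve 4 (λ μ ν s t → μ :+ ν :+ (s :+ t) := μ :+ s :+ (ν :+ t)) refl μ ν (sumℚ μs) (sumℚ νs))

sumℚ-* : ∀ c μs → sumℚ (map (c ℚ.*_) μs) ≡ c ℚ.* sumℚ μs
sumℚ-* c []       = sym (ℚP.*-zeroʳ c)
sumℚ-* c (μ ∷ μs) = trans (cong (c ℚ.* μ ℚ.+_) (sumℚ-* c μs)) (sym (ℚP.*-distribˡ-+ c μ (sumℚ μs)))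

coordℚ : Fin 3 → Point → ℚ
coordℚ k v = toℚ (coord v k)

-- (x , s) is a nonnegative combination of the lifted points (v , 1), v ∈ V;
-- for s = 1 this is InConv V with nonnegativity stated by All.
InCone : List Point → ℚ → (Fin 3 → ℚ) → Set
InCone V s x =
  Σ (List ℚ) λ μs → (length μs ≡ length V) × All (0ℚ ℚ.≤_) μs × (sumℚ μs ≡ s) ×
    ((k : Fin 3) → weighted μs V (coordℚ k) ≡ x k)

module _ {V : List Point} where

  cone-cong : ∀ {s t x y} → s ≡ t → (∀ k → x k ≡ y k) → InCone V s x → InCone V t y
  cone-cong s≡t x≗y (μs , len , nonneg , total , centre) =
    μs , len , nonneg , trans total s≡t , λ k → trans (centre k) (x≗y k)

  cone-+ : ∀ {s t x y} → InCone V s x → InCone V t y → InCone V (s ℚ.+ t) (λ k → x k ℚ.+ y k)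
  cone-+ (μs , lμ , nμ , sμ , cμ) (νs , lν , nν , sν , cν) =
    zipWith ℚ._+_ μs νs ,
    trans (length-zipWith ℚ._+_ μs νs) (trans (cong₂ ℕ._⊓_ lμ lν) (ℕP.⊓-idem (length V))) ,
    nonneg-+ μs νs nμ nν ,
    trans (sumℚ-+ μs νs (trans lμ (sym lν))) (cong₂ ℚ._+_ sμ sν) ,
    λ k → trans (weighted-+ μs νs V (coordℚ k) lμ lν) (cong₂ ℚ._+_ (cμ k) (cν k))
    where
      nonneg-+ : ∀ μs νs → All (0ℚ ℚ.≤_) μs → All (0ℚ ℚ.≤_) νs → All (0ℚ ℚ.≤_) (zipWith ℚ._+_ μs νs)
      nonneg-+ []       νs       []          _           = []
      nonneg-+ (μ ∷ μs) []       _           []          = []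
      nonneg-+ (μ ∷ μs) (ν ∷ νs) (0≤μ ∷ nμ) (0≤ν ∷ nν) = ℚP.+-mono-≤ 0≤μ 0≤ν ∷ nonneg-+ μs νs nμ nν

  cone-* : ∀ {s x} c → 0ℚ ℚ.≤ c → InCone V s x → InCone V (c ℚ.* s) (λ k → c ℚ.* x k)
  cone-* c 0≤c (μs , len , nonneg , total , centre) =
    map (c ℚ.*_) μs ,
    trans (length-map (c ℚ.*_) μs) len ,
    map⁺ (All.map nonneg-* nonneg) ,
    trans (sumℚ-* c μs) (cong (c ℚ.*_) total) ,
    λ k → trans (weighted-* c μs V (coordℚ k)) (cong (c ℚ.*_) (centre k))
    where
      nonneg-* : ∀ {μ} → 0ℚ ℚ.≤ μ → 0ℚ ℚ.≤ c ℚ.* μ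
      nonneg-* {μ} 0≤μ =
        ℚP.nonNegative⁻¹ _ {{ℚP.nonNeg*nonNeg⇒nonNeg c {{ℚ.nonNegative 0≤c}} μ {{ℚ.nonNegative 0≤μ}}}}

cone-vertex : ∀ {V v} → v ∈ V → InCone V 1ℚ (λ k → coordℚ k v)
cone-vertex {v ∷ V} (here refl) =
  1ℚ ∷ replicate (length V) 0ℚ ,
  cong suc (length-replicate (length V)) ,
  ℚP.nonNegative⁻¹ 1ℚ ∷ zeros-nonneg (length V) ,
  trans (cong (1ℚ ℚ.+_) (zeros-sum (length V))) (ℚP.+-identityʳ 1ℚ) ,
  λ k → trans (cong₂ ℚ._+_ (ℚP.*-identityˡ (coordℚ k v)) (zeros-weighted (length V) V k)) (ℚP.+-identityʳ (coordℚ k v))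
  where
    zeros-nonneg : ∀ n → All (0ℚ ℚ.≤_) (replicate n 0ℚ)
    zeros-nonneg zero    = []
    zeros-nonneg (suc n) = ℚP.≤-refl ∷ zeros-nonneg n
    zeros-sum : ∀ n → sumℚ (replicate n 0ℚ) ≡ 0ℚ
    zeros-sum zero    = refl
    zeros-sum (suc n) = trans (ℚP.+-identityˡ _) (zeros-sum n)
    zeros-weighted : ∀ n V k → weighted (replicate n 0ℚ) V (coordℚ k) ≡ 0ℚ
    zeros-weighted zero    V       k = refl
    zeros-weighted (suc n) []      k = refl
    zeros-weighted (suc n) (u ∷ V) k =
      trans (cong₂ ℚ._+_ (ℚP.*-zeroˡ (coordℚ k u)) (zeros-weighted n V k)) (ℚP.+-identityˡ 0ℚ)
cone-vertex {u ∷ V} {v} (there v∈V) with cone-vertex v∈V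
... | μs , len , nonneg , total , centre =
  0ℚ ∷ μs , cong suc len , ℚP.≤-refl ∷ nonneg , trans (ℚP.+-identityˡ (sumℚ μs)) total ,
  λ k → trans (cong₂ ℚ._+_ (ℚP.*-zeroˡ (coordℚ k u)) (centre k)) (ℚP.+-identityˡ (coordℚ k v))

-- p ∈ d · conv V.  A record rather than a definition so that d and p can be inferred.
record InDilation (V : List Point) (d : ℕ) (p : Point) : Set where
  constructor dilation
  field cone : InCone V (toℚ (+ d)) (λ k → coordℚ k p)

module _ {V : List Point} where

  InConv⇒InDilation : ∀ {p} → InConv V p → InDilation V 1 p
  InConv⇒InDilation (λs , len , nonneg , total , centre) = dilation (λs , len , All.tabulate (nonneg _) , total , centre)

  InDilation⇒InConv : ∀ {p} → InDilation V 1 p → InConv V p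
  InDilation⇒InConv (dilation (μs , len , nonneg , total , centre)) = μs , len , (λ _ → All.lookup nonneg) , total , centre

  dilation-+ : ∀ {d e p q} → InDilation V d p → InDilation V e q → InDilation V (d ℕ.+ e) (p ⊕ q)
  dilation-+ {d} {e} {p} {q} (dilation p∈) (dilation q∈) = dilation $
    cone-cong (sym (toℚ-+ (+ d) (+ e)))
              (λ k → trans (sym (toℚ-+ (coord p k) (coord q k))) (cong toℚ (sym (lookup-zipWith ℤ._+_ k p q))))
              (cone-+ p∈ q∈)

  dilation-scale : ∀ {d p} k → InDilation V d p → InDilation V (k ℕ.* d) (k ⊛ p)
  dilation-scale {d} {p} k (dilation p∈) = dilation $
    cone-cong (trans (sym (toℚ-* (+ k) (+ d))) (cong toℚ (sym (ℤP.pos-* k d))))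
              (λ i → trans (sym (toℚ-* (+ k) (coord p i))) (cong toℚ (sym (lookup-map i (+ k ℤ.*_) p))))
              (cone-* (toℚ (+ k)) (ℚP.nonNegative⁻¹ _ {{ℚP.normalize-nonNeg k 1}}) p∈)

  dilation-divide : ∀ {d p} k .{{_ : ℕ.NonZero k}} → InDilation V (k ℕ.* d) (k ⊛ p) → InDilation V d p
  dilation-divide {d} {p} k (dilation kp∈) = dilation $
    cone-cong (trans (cong (λ t → 1/k ℚ.* toℚ t) (ℤP.pos-* k d)) (cancel (+ d)))
              (λ i → trans (cong (λ t → 1/k ℚ.* toℚ t) (lookup-map i (+ k ℤ.*_) p)) (cancel (coord p i)))
              (cone-* 1/k (ℚP.nonNegative⁻¹ _ {{ℚP.pos⇒nonNeg 1/k {{ℚP.1/pos⇒pos K}}}}) kp∈)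
    where
      K : ℚ
      K = toℚ (+ k)
      instance
        K-positive : ℚ.Positive K
        K-positive = ℚP.normalize-pos k 1
        K-nonZero : ℚ.NonZero K
        K-nonZero = ℚP.pos⇒nonZero K
      1/k : ℚ
      1/k = ℚ.1/ K
      cancel : ∀ a → 1/k ℚ.* toℚ (+ k ℤ.* a) ≡ toℚ a
      cancel a = begin
        1/k ℚ.* toℚ (+ k ℤ.* a)    ≡⟨ cong (1/k ℚ.*_) (toℚ-* (+ k) a) ⟩
        1/k ℚ.* (K ℚ.* toℚ a)      ≡⟨ ℚP.*-assoc 1/k K (toℚ a) ⟨
        (1/k ℚ.* K) ℚ.* toℚ a      ≡⟨ cong (ℚ._* toℚ a) (ℚP.*-inverseˡ K) ⟩
        1ℚ ℚ.* toℚ a               ≡⟨ ℚP.*-identityˡ (toℚ a) ⟩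
        toℚ a                      ∎
        where open ≡-Reasoning

  -- z = x + j and y = z + m: then m·(p[i]≔x) + j·(p[i]≔y) = (j + m)·(p[i]≔z).
  dilation-segment : ∀ {d} p i {x y z} → InDilation V d (p [ i ]≔ x) → InDilation V d (p [ i ]≔ y) →
                     x ℤ.≤ z → z ℤ.≤ y → InDilation V d (p [ i ]≔ z)
  dilation-segment {d} p i {x} x∈ y∈ x≤z z≤y with ≤⇒offset x≤z | ≤⇒offset z≤y
  ... | zero , refl | _ = subst (λ t → InDilation V d (p [ i ]≔ t)) (sym (ℤP.+-identityʳ x)) x∈
  ... | suc j-1 , refl | m , refl =
    dilation-divide (j ℕ.+ m) $
      subst₂ (InDilation V) (levels m j d) (point-ext combine) (dilation-+ (dilation-scale m x∈) (dilation-scale j y∈))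
    where
      j = suc j-1
      levels : ∀ m j d → m ℕ.* d ℕ.+ j ℕ.* d ≡ (j ℕ.+ m) ℕ.* d
      levels = ℕ-Solver.solve-∀
      on-line : ∀ m j x → m ℤ.* x ℤ.+ j ℤ.* (x ℤ.+ j ℤ.+ m) ≡ (j ℤ.+ m) ℤ.* (x ℤ.+ j)
      on-line = solve-∀
      off-line : ∀ m j a → m ℤ.* a ℤ.+ j ℤ.* a ≡ (j ℤ.+ m) ℤ.* a
      off-line = solve-∀
      pointwise : ∀ k → + m ℤ.* coord (p [ i ]≔ x) k ℤ.+ + j ℤ.* coord (p [ i ]≔ (x ℤ.+ + j ℤ.+ + m)) k
                      ≡ (+ j ℤ.+ + m) ℤ.* coord (p [ i ]≔ (x ℤ.+ + j)) k
      pointwise k with k ≟ i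
      ... | yes refl
        rewrite lookup∘update k p x | lookup∘update k p (x ℤ.+ + j ℤ.+ + m)
              | lookup∘update k p (x ℤ.+ + j)
        = on-line (+ m) (+ j) x
      ... | no k≢i
        rewrite lookup∘update′ k≢i p x | lookup∘update′ k≢i p (x ℤ.+ + j ℤ.+ + m)
              | lookup∘update′ k≢i p (x ℤ.+ + j)
        = off-line (+ m) (+ j) (coord p k)
      combine : ∀ k → coord (m ⊛ (p [ i ]≔ x) ⊕ j ⊛ (p [ i ]≔ (x ℤ.+ + j ℤ.+ + m))) k
                    ≡ coord ((j ℕ.+ m) ⊛ (p [ i ]≔ (x ℤ.+ + j))) k
      combine k = begin
        coord (m ⊛ (p [ i ]≔ x) ⊕ j ⊛ (p [ i ]≔ (x ℤ.+ + j ℤ.+ + m))) k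
          ≡⟨ coord-combination m j (p [ i ]≔ x) (p [ i ]≔ (x ℤ.+ + j ℤ.+ + m)) k ⟩
        + m ℤ.* coord (p [ i ]≔ x) k ℤ.+ + j ℤ.* coord (p [ i ]≔ (x ℤ.+ + j ℤ.+ + m)) k
          ≡⟨ pointwise k ⟩
        (+ j ℤ.+ + m) ℤ.* coord (p [ i ]≔ (x ℤ.+ + j)) k
          ≡⟨ cong (ℤ._* coord (p [ i ]≔ (x ℤ.+ + j)) k) (ℤP.pos-+ j m) ⟨
        + (j ℕ.+ m) ℤ.* coord (p [ i ]≔ (x ℤ.+ + j)) k
          ≡⟨ lookup-map k (+ (j ℕ.+ m) ℤ.*_) (p [ i ]≔ (x ℤ.+ + j)) ⟨
        coord ((j ℕ.+ m) ⊛ (p [ i ]≔ (x ℤ.+ + j))) k ∎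
        where open ≡-Reasoning

∈⇒InConv : ∀ {V p} → p ∈ V → InConv V p
∈⇒InConv {p = p} p∈V = InDilation⇒InConv (dilation {p = p} (cone-vertex p∈V))

conv-segment : ∀ {V} p i {x y z} → InConv V (p [ i ]≔ x) → InConv V (p [ i ]≔ y) →
               x ℤ.≤ z → z ℤ.≤ y → InConv V (p [ i ]≔ z)
conv-segment p i x∈ y∈ x≤z z≤y =
  InDilation⇒InConv (dilation-segment p i (InConv⇒InDilation x∈) (InConv⇒InDilation y∈) x≤z z≤y)

WidthGt1⇒¬narrow : ∀ {V} → WidthGt1 V → ∀ c → ¬ (∀ k → coord c k ≡ + 0) → ∀ lo →
                   ¬ (∀ p → InConv V p → lo ℤ.≤ lin c p × lin c p ℤ.≤ lo ℤ.+ + 1)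
WidthGt1⇒¬narrow width c c≢0 lo narrow with width c c≢0
... | u , w , u∈ , w∈ , wide = 2≰1 (ℤP.≤-trans wide (begin
  lin c u ℤ.- lin c w    ≤⟨ ℤP.+-mono-≤ (proj₂ (narrow u (∈⇒InConv u∈)))
                                         (ℤP.neg-mono-≤ (proj₁ (narrow w (∈⇒InConv w∈)))) ⟩
  (lo ℤ.+ + 1) ℤ.- lo    ≡⟨ unit-slab lo ⟩
  + 1                    ∎))
  where
    open ℤP.≤-Reasoning
    unit-slab : ∀ lo → (lo ℤ.+ + 1) ℤ.- lo ≡ + 1
    unit-slab = solve-∀
    2≰1 : ¬ (+ 2 ℤ.≤ + 1)
    2≰1 (+≤+ (s≤s ()))

-- Symmetries of the unit cube

reflect : Bool → ℤ → ℤ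
reflect false x = x
reflect true  x = + 1 ℤ.- x

reflect-involutive : ∀ b x → reflect b (reflect b x) ≡ x
reflect-involutive false x = refl
reflect-involutive true  x = cancel x
  where
    cancel : ∀ x → + 1 ℤ.- (+ 1 ℤ.- x) ≡ x
    cancel = solve-∀

IsBit-reflect : ∀ b {x} → IsBit x → IsBit (reflect b x)
IsBit-reflect false x-bit = x-bit
IsBit-reflect true (inj₁ refl) = inj₂ refl
IsBit-reflect true (inj₂ refl) = inj₁ refl

IsBit-reflect⁻ : ∀ b {x} → IsBit (reflect b x) → IsBit x
IsBit-reflect⁻ b {x} bit = subst IsBit (reflect-involutive b x) (IsBit-reflect b bit)

dval-reflect : ∀ b x → dval (reflect b x) ≡ dval x
dval-reflect false x = refl
dval-reflect true  x = trans (cong₂ ℤ._⊔_ (shift x) (negate x)) (ℤP.⊔-comm (- x) (x ℤ.- + 1))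
  where
    shift : ∀ x → (+ 1 ℤ.- x) ℤ.- + 1 ≡ - x
    shift = solve-∀
    negate : ∀ x → - (+ 1 ℤ.- x) ≡ x ℤ.- + 1
    negate = solve-∀

sign : Bool → ℤ
sign false = + 1
sign true  = -[1+ 0 ]

reflect-sub : ∀ b x y → reflect b x ℤ.- reflect b y ≡ sign b ℤ.* (x ℤ.- y)
reflect-sub false x y = sym (ℤP.*-identityˡ (x ℤ.- y))
reflect-sub true  x y = flipped-difference x y
  where
    flipped-difference : ∀ x y → (+ 1 ℤ.- x) ℤ.- (+ 1 ℤ.- y) ≡ -[1+ 0 ] ℤ.* (x ℤ.- y)
    flipped-difference = solve-∀

sign-cancel : ∀ b {x} → sign b ℤ.* x ≡ + 0 → x ≡ + 0
sign-cancel false {x} eq = trans (sym (ℤP.*-identityˡ x)) eq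
sign-cancel true  {x} eq = trans (sym (ℤP.neg-involutive x)) (cong -_ (trans (sym (ℤP.-1*i≡-i x)) eq))

weighted-reflect : ∀ b λs V i {x} → length λs ≡ length V → sumℚ λs ≡ 1ℚ →
                   weighted λs V (coordℚ i) ≡ toℚ x →
                   weighted λs V (λ v → toℚ (reflect b (coord v i))) ≡ toℚ (reflect b x)
weighted-reflect false λs V i len total centre = centre
weighted-reflect true  λs V i {x} len total centre = begin
  weighted λs V (λ v → toℚ (+ 1 ℤ.- coord v i))   ≡⟨ weighted-cong λs V (λ v → toℚ-1- (coord v i)) ⟩
  weighted λs V (λ v → 1ℚ ℚ.- coordℚ i v)         ≡⟨ weighted-1- λs V (coordℚ i) len ⟩
  sumℚ λs ℚ.- weighted λs V (coordℚ i)            ≡⟨ cong₂ ℚ._-_ total centre ⟩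
  1ℚ ℚ.- toℚ x                                    ≡⟨ toℚ-1- x ⟨
  toℚ (+ 1 ℤ.- x)                                 ∎
  where
    open ≡-Reasoning
    toℚ-1- : ∀ x → toℚ (+ 1 ℤ.- x) ≡ 1ℚ ℚ.- toℚ x
    toℚ-1- x = trans (toℚ-+ (+ 1) (- x)) (cong (1ℚ ℚ.+_) (toℚ-neg x))

record SignedPermutation : Set where
  field
    perm    : Permutation′ 3
    flipped : Fin 3 → Bool

open SignedPermutation

act : SignedPermutation → Point → Point
act σ p = tabulate (λ k → reflect (flipped σ k) (coord p (perm σ ⟨$⟩ʳ k)))

coord-act : ∀ σ p k → coord (act σ p) k ≡ reflect (flipped σ k) (coord p (perm σ ⟨$⟩ʳ k))
coord-act σ p = lookup∘tabulate _

inverse : SignedPermutation → SignedPermutation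
inverse σ = record { perm = Perm.flip (perm σ) ; flipped = flipped σ ∘ (perm σ ⟨$⟩ˡ_) }

act-inverseˡ : ∀ σ p → act (inverse σ) (act σ p) ≡ p
act-inverseˡ σ p = point-ext λ j → begin
  coord (act (inverse σ) (act σ p)) j
    ≡⟨ coord-act (inverse σ) (act σ p) j ⟩
  reflect (flipped σ (π⁻¹ j)) (coord (act σ p) (π⁻¹ j))
    ≡⟨ cong (reflect (flipped σ (π⁻¹ j))) (coord-act σ p (π⁻¹ j)) ⟩
  reflect (flipped σ (π⁻¹ j)) (reflect (flipped σ (π⁻¹ j)) (coord p (π (π⁻¹ j))))
    ≡⟨ reflect-involutive (flipped σ (π⁻¹ j)) _ ⟩
  coord p (π (π⁻¹ j))
    ≡⟨ cong (coord p) (Perm.inverseʳ (perm σ)) ⟩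
  coord p j ∎
  where
    open ≡-Reasoning
    π = perm σ ⟨$⟩ʳ_
    π⁻¹ = perm σ ⟨$⟩ˡ_

act-inverseʳ : ∀ σ p → act σ (act (inverse σ) p) ≡ p
act-inverseʳ σ p = point-ext λ k → begin
  coord (act σ (act (inverse σ) p)) k
    ≡⟨ coord-act σ (act (inverse σ) p) k ⟩
  reflect (flipped σ k) (coord (act (inverse σ) p) (π k))
    ≡⟨ cong (reflect (flipped σ k)) (coord-act (inverse σ) p (π k)) ⟩
  reflect (flipped σ k) (reflect (flipped σ (π⁻¹ (π k))) (coord p (π⁻¹ (π k))))
    ≡⟨ cong (λ i → reflect (flipped σ k) (reflect (flipped σ i) (coord p i))) (Perm.inverseˡ (perm σ)) ⟩
  reflect (flipped σ k) (reflect (flipped σ k) (coord p k))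
    ≡⟨ reflect-involutive (flipped σ k) (coord p k) ⟩
  coord p k ∎
  where
    open ≡-Reasoning
    π = perm σ ⟨$⟩ʳ_
    π⁻¹ = perm σ ⟨$⟩ˡ_

InConv-act : ∀ σ {V} p → InConv V p → InConv (map (act σ) V) (act σ p)
InConv-act σ {V} p (λs , len , nonneg , total , centre) =
  λs , trans len (sym (length-map (act σ) V)) , nonneg , total , λ k → begin
    weighted λs (map (act σ) V) (coordℚ k)
      ≡⟨ weighted-map λs V (act σ) (coordℚ k) ⟩
    weighted λs V (λ v → toℚ (coord (act σ v) k))
      ≡⟨ weighted-cong λs V (λ v → cong toℚ (coord-act σ v k)) ⟩
    weighted λs V (λ v → toℚ (reflect (flipped σ k) (coord v (π k))))
      ≡⟨ weighted-reflect (flipped σ k) λs V (π k) len total (centre (π k)) ⟩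
    toℚ (reflect (flipped σ k) (coord p (π k)))
      ≡⟨ cong toℚ (coord-act σ p k) ⟨
    toℚ (coord (act σ p) k) ∎
  where
    open ≡-Reasoning
    π = perm σ ⟨$⟩ʳ_

map-act-inverse : ∀ σ V → map (act (inverse σ)) (map (act σ) V) ≡ V
map-act-inverse σ V = trans (sym (map-∘ V)) (trans (map-cong (act-inverseˡ σ) V) (map-id V))

InConv-act⁻¹ : ∀ σ {V} q → InConv (map (act σ) V) q → InConv V (act (inverse σ) q)
InConv-act⁻¹ σ {V} q q∈ =
  subst (λ W → InConv W (act (inverse σ) q)) (map-act-inverse σ V) (InConv-act (inverse σ) q q∈)

InCube-act : ∀ σ p → InCube p → InCube (act σ p)
InCube-act σ p p∈ k = subst IsBit (sym (coord-act σ p k)) (IsBit-reflect (flipped σ k) (p∈ (perm σ ⟨$⟩ʳ k)))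

InCube-act⁻¹ : ∀ σ p → InCube (act σ p) → InCube p
InCube-act⁻¹ σ p σp∈ = subst InCube (act-inverseˡ σ p) (InCube-act (inverse σ) (act σ p) σp∈)

lin-sub : ∀ c u w → lin c u ℤ.- lin c w ≡ sum (λ k → coord c k ℤ.* (coord u k ℤ.- coord w k))
lin-sub (c₀ ∷ c₁ ∷ c₂ ∷ []) (u₀ ∷ u₁ ∷ u₂ ∷ []) (w₀ ∷ w₁ ∷ w₂ ∷ []) =
  expand c₀ c₁ c₂ u₀ u₁ u₂ w₀ w₁ w₂
  where
    expand : ∀ c₀ c₁ c₂ u₀ u₁ u₂ w₀ w₁ w₂ →
      (c₀ ℤ.* u₀ ℤ.+ c₁ ℤ.* u₁ ℤ.+ c₂ ℤ.* u₂) ℤ.- (c₀ ℤ.* w₀ ℤ.+ c₁ ℤ.* w₁ ℤ.+ c₂ ℤ.* w₂)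
        ≡
      c₀ ℤ.* (u₀ ℤ.- w₀) ℤ.+ (c₁ ℤ.* (u₁ ℤ.- w₁) ℤ.+ (c₂ ℤ.* (u₂ ℤ.- w₂) ℤ.+ + 0))
    expand = solve-∀

dual : SignedPermutation → Point → Point
dual σ c = tabulate λ j → sign (flipped σ (perm σ ⟨$⟩ˡ j)) ℤ.* coord c (perm σ ⟨$⟩ˡ j)

coord-dual : ∀ σ c k → coord (dual σ c) (perm σ ⟨$⟩ʳ k) ≡ sign (flipped σ k) ℤ.* coord c k
coord-dual σ c k =
  trans (lookup∘tabulate (λ j → sign (flipped σ (π⁻¹ j)) ℤ.* coord c (π⁻¹ j)) (perm σ ⟨$⟩ʳ k))
        (cong (λ i → sign (flipped σ i) ℤ.* coord c i) (Perm.inverseˡ (perm σ)))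
  where π⁻¹ = perm σ ⟨$⟩ˡ_

lin-act : ∀ σ c u w → lin c (act σ u) ℤ.- lin c (act σ w) ≡ lin (dual σ c) u ℤ.- lin (dual σ c) w
lin-act σ c u w = begin
  lin c (act σ u) ℤ.- lin c (act σ w)
    ≡⟨ lin-sub c (act σ u) (act σ w) ⟩
  sum (λ k → coord c k ℤ.* (coord (act σ u) k ℤ.- coord (act σ w) k))
    ≡⟨ sum-cong-≗ moved ⟩
  sum (λ k → coord (dual σ c) (π k) ℤ.* (coord u (π k) ℤ.- coord w (π k)))
    ≡⟨ sum-permute (λ j → coord (dual σ c) j ℤ.* (coord u j ℤ.- coord w j)) (perm σ) ⟨
  sum (λ j → coord (dual σ c) j ℤ.* (coord u j ℤ.- coord w j))
    ≡⟨ lin-sub (dual σ c) u w ⟨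
  lin (dual σ c) u ℤ.- lin (dual σ c) w ∎
  where
    open ≡-Reasoning
    π = perm σ ⟨$⟩ʳ_
    reassociate : ∀ c s d → c ℤ.* (s ℤ.* d) ≡ s ℤ.* c ℤ.* d
    reassociate = solve-∀
    moved : ∀ k → coord c k ℤ.* (coord (act σ u) k ℤ.- coord (act σ w) k)
                ≡ coord (dual σ c) (π k) ℤ.* (coord u (π k) ℤ.- coord w (π k))
    moved k = begin
      coord c k ℤ.* (coord (act σ u) k ℤ.- coord (act σ w) k)
        ≡⟨ cong (coord c k ℤ.*_) (cong₂ ℤ._-_ (coord-act σ u k) (coord-act σ w k)) ⟩
      coord c k ℤ.* (reflect (flipped σ k) (coord u (π k)) ℤ.- reflect (flipped σ k) (coord w (π k)))
        ≡⟨ cong (coord c k ℤ.*_) (reflect-sub (flipped σ k) (coord u (π k)) (coord w (π k))) ⟩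
      coord c k ℤ.* (sign (flipped σ k) ℤ.* (coord u (π k) ℤ.- coord w (π k)))
        ≡⟨ reassociate (coord c k) (sign (flipped σ k)) (coord u (π k) ℤ.- coord w (π k)) ⟩
      sign (flipped σ k) ℤ.* coord c k ℤ.* (coord u (π k) ℤ.- coord w (π k))
        ≡⟨ cong (ℤ._* (coord u (π k) ℤ.- coord w (π k))) (coord-dual σ c k) ⟨
      coord (dual σ c) (π k) ℤ.* (coord u (π k) ℤ.- coord w (π k)) ∎

dual-nonzero : ∀ σ c → ¬ (∀ k → coord c k ≡ + 0) → ¬ (∀ j → coord (dual σ c) j ≡ + 0)
dual-nonzero σ c c≢0 dual≡0 =
  c≢0 λ k → sign-cancel (flipped σ k) (trans (sym (coord-dual σ c k)) (dual≡0 (perm σ ⟨$⟩ʳ k)))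

WidthGt1-act : ∀ σ {V} → WidthGt1 V → WidthGt1 (map (act σ) V)
WidthGt1-act σ width c c≢0 with width (dual σ c) (dual-nonzero σ c c≢0)
... | u , w , u∈ , w∈ , wide =
  act σ u , act σ w , ∈-map⁺ (act σ) u∈ , ∈-map⁺ (act σ) w∈ , subst (+ 2 ℤ.≤_) (sym (lin-act σ c u w)) wide

perm-injective : ∀ σ {i j} → perm σ ⟨$⟩ʳ i ≡ perm σ ⟨$⟩ʳ j → i ≡ j
perm-injective σ {i} {j} eq =
  trans (sym (Perm.inverseˡ (perm σ))) (trans (cong (perm σ ⟨$⟩ˡ_) eq) (Perm.inverseˡ (perm σ)))

Boxed-act : ∀ σ {V v} → Boxed V v → Boxed (map (act σ) V) (λ j → act σ (v (perm σ ⟨$⟩ʳ j)))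
Boxed-act σ {V} {v} (width , v∈ , v∉ , outside , diagonal) =
  WidthGt1-act σ width ,
  (λ j → InConv-act σ (v (π j)) (v∈ (π j))) ,
  (λ j → v∉ (π j) ∘ InCube-act⁻¹ σ (v (π j))) ,
  outside′ ,
  λ i j → mk⇔ (λ nonbit → perm-injective σ (Equivalence.to (diagonal (π i) (π j)) (nonbit ∘ bit-act i j)))
              (λ { refl → Equivalence.from (diagonal (π i) (π i)) refl ∘ bit-act⁻¹ i i })
  where
    π = perm σ ⟨$⟩ʳ_
    π⁻¹ = perm σ ⟨$⟩ˡ_
    bit-act : ∀ i j → IsBit (coord (v (π j)) (π i)) → IsBit (coord (act σ (v (π j))) i)
    bit-act i j bit = subst IsBit (sym (coord-act σ (v (π j)) i)) (IsBit-reflect (flipped σ i) bit)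
    bit-act⁻¹ : ∀ i j → IsBit (coord (act σ (v (π j))) i) → IsBit (coord (v (π j)) (π i))
    bit-act⁻¹ i j bit = IsBit-reflect⁻ (flipped σ i) (subst IsBit (coord-act σ (v (π j)) i) bit)
    outside′ : ∀ q → InConv (map (act σ) V) q → ¬ InCube q → ∃ λ j → q ≡ act σ (v (π j))
    outside′ q q∈ q∉ with outside (act (inverse σ) q) (InConv-act⁻¹ σ q q∈)
                                  (q∉ ∘ subst InCube (act-inverseʳ σ q) ∘ InCube-act σ (act (inverse σ) q))
    ... | i , eq = π⁻¹ i , (begin
      q                          ≡⟨ act-inverseʳ σ q ⟨
      act σ (act (inverse σ) q)  ≡⟨ cong (act σ) eq ⟩
      act σ (v i)                ≡⟨ cong (act σ ∘ v) (Perm.inverseʳ (perm σ)) ⟨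
      act σ (v (π (π⁻¹ i)))      ∎)
      where open ≡-Reasoning

IsFacet : List Point → Fin 3 → ℤ → Set
IsFacet V f b = (p : Point) → InCube p → (InConv V p ⇔ (coord p f ≡ b))

IsFacet-act : ∀ σ {V f b} → IsFacet V f b →
              IsFacet (map (act σ) V) (perm σ ⟨$⟩ˡ f) (reflect (flipped σ (perm σ ⟨$⟩ˡ f)) b)
IsFacet-act σ {V} {f} {b} facet q q∈ = mk⇔
  (λ q∈P → reflect-swap (trans (sym (coord-act σ⁻¹ q f)) (Equivalence.to (facet′) (InConv-act⁻¹ σ q q∈P))))
  (λ on-facet → subst (InConv (map (act σ) V)) (act-inverseʳ σ q)
                  (InConv-act σ (act σ⁻¹ q) (Equivalence.from facet′
                    (trans (coord-act σ⁻¹ q f) (reflect-swap′ on-facet)))))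
  where
    σ⁻¹ = inverse σ
    r = flipped σ (perm σ ⟨$⟩ˡ f)
    facet′ = facet (act σ⁻¹ q) (InCube-act σ⁻¹ q q∈)
    reflect-swap : ∀ {x} → reflect r x ≡ b → x ≡ reflect r b
    reflect-swap {x} eq = trans (sym (reflect-involutive r x)) (cong (reflect r) eq)
    reflect-swap′ : ∀ {x} → x ≡ reflect r b → reflect r x ≡ b
    reflect-swap′ {x} eq = trans (cong (reflect r) eq) (reflect-involutive r b)

DiagonalBounded : (Fin 3 → Point) → Set
DiagonalBounded v = ∀ i → dval (coord (v i) i) ≤ + 6

DiagonalBounded-act⁻¹ : ∀ σ {v} → DiagonalBounded (λ j → act σ (v (perm σ ⟨$⟩ʳ j))) → DiagonalBounded v
DiagonalBounded-act⁻¹ σ {v} bounded i = subst (_≤ + 6) (begin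
  dval (coord (act σ (v (π j))) j)                     ≡⟨ cong dval (coord-act σ (v (π j)) j) ⟩
  dval (reflect (flipped σ j) (coord (v (π j)) (π j)))  ≡⟨ dval-reflect (flipped σ j) (coord (v (π j)) (π j)) ⟩
  dval (coord (v (π j)) (π j))                         ≡⟨ cong (λ k → dval (coord (v k) k)) (Perm.inverseʳ (perm σ)) ⟩
  dval (coord (v i) i)                                 ∎) (bounded j)
  where
    open ≡-Reasoning
    π = perm σ ⟨$⟩ʳ_
    j = perm σ ⟨$⟩ˡ i

reflection : Fin 3 → SignedPermutation
reflection i = record { perm = Perm.id ; flipped = λ k → does (k ≟ i) }

transposition : Fin 3 → Fin 3 → SignedPermutation
transposition i j = record { perm = Perm.transpose i j ; flipped = λ _ → false }

-- Polytopes boxed over the floor z = 0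

-- The x-, y- and z-vertex are v 0F, v 1F and v 2F.
module Floor {V : List Point} {v : Fin 3 → Point} (boxed : Boxed V v) (facet : IsFacet V 2F (+ 0)) where

  width : WidthGt1 V
  width = proj₁ boxed

  vertex-in : ∀ j → InConv V (v j)
  vertex-in = proj₁ (proj₂ boxed)

  outside : ∀ p → InConv V p → ¬ InCube p → ∃ λ j → p ≡ v j
  outside = proj₁ (proj₂ (proj₂ (proj₂ boxed)))

  diagonal : ∀ i j → (¬ IsBit (coord (v j) i)) ⇔ (i ≡ j)
  diagonal = proj₂ (proj₂ (proj₂ (proj₂ boxed)))

  floor : ∀ {x y} → IsBit x → IsBit y → InConv V (x ∷ y ∷ + 0 ∷ [])
  floor {x} {y} x-bit y-bit = Equivalence.from (facet (x ∷ y ∷ + 0 ∷ []) cube) refl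
    where
      cube : InCube (x ∷ y ∷ + 0 ∷ [])
      cube 0F = x-bit
      cube 1F = y-bit
      cube 2F = inj₁ refl

  on-floor : ∀ p → InConv V p → InCube p → coord p 2F ≡ + 0
  on-floor p p∈ cube = Equivalence.to (facet p cube) p∈

  off-diagonal-bit : ∀ {i j} → i ≢ j → IsBit (coord (v j) i)
  off-diagonal-bit {i} {j} i≢j = decidable-stable (isBit? _) (i≢j ∘ Equivalence.to (diagonal i j))

  diagonal-non-bit : ∀ j → ¬ IsBit (coord (v j) j)
  diagonal-non-bit j = Equivalence.from (diagonal j j) refl

  non-bit-coordinate : ∀ p i → InConv V p → ¬ IsBit (coord p i) → coord p i ≡ coord (v i) i
  non-bit-coordinate p i p∈ non-bit with outside p p∈ (non-bit ∘ (_$ i))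
  ... | j , refl with i ≟ j
  ...   | yes refl = refl
  ...   | no i≢j = ⊥-elim (non-bit (off-diagonal-bit i≢j))

  z-vertex-height : coord (v 2F) 2F ≡ -[1+ 0 ]
  z-vertex-height = height (coord (v 2F) 2F) refl
    where
      s = coord (v 2F) 0F
      t = coord (v 2F) 1F
      s-bit = off-diagonal-bit {0F} {2F} λ ()
      t-bit = off-diagonal-bit {1F} {2F} λ ()
      z-vertex-at : ∀ {a} → coord (v 2F) 2F ≡ a → InConv V (s ∷ t ∷ a ∷ [])
      z-vertex-at eq = subst (InConv V) (trans (point-η (v 2F)) (cong (λ a → s ∷ t ∷ a ∷ []) eq)) (vertex-in 2F)
      height : ∀ a → coord (v 2F) 2F ≡ a → a ≡ -[1+ 0 ]
      height (+ 0) eq = ⊥-elim (diagonal-non-bit 2F (inj₁ eq))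
      height (+ 1) eq = ⊥-elim (diagonal-non-bit 2F (inj₂ eq))
      height (+ suc (suc n)) eq = case on-floor (s ∷ t ∷ + 1 ∷ []) above-floor cube of λ ()
        where
          above-floor = conv-segment (s ∷ t ∷ + 0 ∷ []) 2F (floor s-bit t-bit) (z-vertex-at eq) (+≤+ z≤n) (+≤+ (s≤s z≤n))
          cube : InCube (s ∷ t ∷ + 1 ∷ [])
          cube 0F = s-bit
          cube 1F = t-bit
          cube 2F = inj₂ refl
      height -[1+ 0 ] eq = refl
      height -[1+ suc n ] eq = case trans (non-bit-coordinate (s ∷ t ∷ -[1+ 0 ] ∷ []) 2F below-floor non-bit) eq of λ ()
        where
          below-floor : InConv V (s ∷ t ∷ -[1+ 0 ] ∷ [])
          below-floor = conv-segment (s ∷ t ∷ + 0 ∷ []) 2F (z-vertex-at eq) (floor s-bit t-bit) (-≤- z≤n) -≤+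
          non-bit : ¬ IsBit -[1+ 0 ]
          non-bit (inj₁ ())
          non-bit (inj₂ ())

  lattice-point : ∀ p → InConv V p → (InCube p × coord p 2F ≡ + 0) ⊎ ∃ λ j → p ≡ v j
  lattice-point p p∈ with all? (λ k → isBit? (coord p k))
  ... | yes cube = inj₁ (cube , on-floor p p∈ cube)
  ... | no ¬cube = inj₂ (outside p p∈ ¬cube)

  -- Every lattice point of P would satisfy -1 ≤ z - y ≤ 0.
  z-y-slab-impossible : ∀ {a s₂ s₃} →
    v 0F ≡ a ∷ + 1 ∷ + 1 ∷ [] → v 1F ≡ s₂ ∷ + 2 ∷ + 1 ∷ [] → v 2F ≡ s₃ ∷ + 0 ∷ -[1+ 0 ] ∷ [] → ⊥
  z-y-slab-impossible x-vertex y-vertex z-vertex =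
    WidthGt1⇒¬narrow width z-y (λ z-y≡0 → case z-y≡0 1F of λ ()) -[1+ 0 ] in-slab
    where
      z-y : Point
      z-y = + 0 ∷ -[1+ 0 ] ∷ + 1 ∷ []
      InSlab : Point → Set
      InSlab p = -[1+ 0 ] ℤ.≤ lin z-y p × lin z-y p ℤ.≤ + 0
      in-slab : ∀ p → InConv V p → InSlab p
      in-slab p p∈ with lattice-point p p∈
      ... | inj₁ (cube , on-floor) = floor-in-slab p (cube 1F) on-floor
        where
          floor-in-slab : ∀ p → IsBit (coord p 1F) → coord p 2F ≡ + 0 → InSlab p
          floor-in-slab (x ∷ .(+ 0) ∷ .(+ 0) ∷ []) (inj₁ refl) refl = -≤+ , +≤+ z≤n
          floor-in-slab (x ∷ .(+ 1) ∷ .(+ 0) ∷ []) (inj₂ refl) refl = -≤- z≤n , -≤+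
      ... | inj₂ (0F , p≡v) = subst InSlab (sym (trans p≡v x-vertex)) (-≤+ , +≤+ z≤n)
      ... | inj₂ (1F , p≡v) = subst InSlab (sym (trans p≡v y-vertex)) (-≤- z≤n , -≤+)
      ... | inj₂ (2F , p≡v) = subst InSlab (sym (trans p≡v z-vertex)) (-≤- z≤n , -≤+)

  -- A point (w/2, 3/2, 0) or (w/2, -1/2, 0) of P with w ≥ 0.
  BeyondStrip : Set
  BeyondStrip =
    Σ ℤ λ w → + 0 ℤ.≤ w × (InDilation V 2 (w ∷ + 3 ∷ + 0 ∷ []) ⊎ InDilation V 2 (w ∷ -[1+ 0 ] ∷ + 0 ∷ []))

  flat-y-vertex⇒beyond-strip : ∀ {s b} → v 1F ≡ s ∷ b ∷ + 0 ∷ [] → IsBit s → ¬ IsBit b → BeyondStrip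
  flat-y-vertex⇒beyond-strip {s} {b} y-vertex s-bit b-non-bit =
    extra b (subst (InConv V) y-vertex (vertex-in 1F)) b-non-bit
    where
      floor₀ = floor s-bit (inj₁ refl)
      floor₁ = floor s-bit (inj₂ refl)
      w≥0 = ℤP.+-mono-≤ (IsBit⇒nonNeg s-bit) (IsBit⇒nonNeg s-bit)
      extra : ∀ b → InConv V (s ∷ b ∷ + 0 ∷ []) → ¬ IsBit b → BeyondStrip
      extra (+ 0) _ non-bit = ⊥-elim (non-bit (inj₁ refl))
      extra (+ 1) _ non-bit = ⊥-elim (non-bit (inj₂ refl))
      extra (+ suc (suc n)) y∈ _ =
        s ℤ.+ s , w≥0 , inj₁ (dilation-+ (InConv⇒InDilation floor₁) (InConv⇒InDilation above))
        where above = conv-segment (s ∷ + 0 ∷ + 0 ∷ []) 1F floor₁ y∈ (+≤+ (s≤s z≤n)) (+≤+ (s≤s (s≤s z≤n)))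
      extra -[1+ n ] y∈ _ =
        s ℤ.+ s , w≥0 , inj₂ (dilation-+ (InConv⇒InDilation floor₀) (InConv⇒InDilation below))
        where below = conv-segment (s ∷ + 0 ∷ + 0 ∷ []) 1F y∈ floor₀ (-≤- z≤n) -≤+

  raised-y-vertex⇒beyond-strip : ∀ {s b s₃} → v 1F ≡ s ∷ b ∷ + 1 ∷ [] → v 2F ≡ s₃ ∷ + 0 ∷ -[1+ 0 ] ∷ [] →
                                 IsBit s → IsBit s₃ → ¬ IsBit b → b ≢ + 2 → BeyondStrip
  raised-y-vertex⇒beyond-strip {s} {b} {s₃} y-vertex z-vertex s-bit s₃-bit b-non-bit b≢2 =
    extra b (subst (InConv V) y-vertex (vertex-in 1F)) b-non-bit b≢2
    where
      z∈ = subst (InConv V) z-vertex (vertex-in 2F)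
      z+ : ∀ {b} → InConv V (s ∷ b ∷ + 1 ∷ []) → InDilation V 2 (s₃ ℤ.+ s ∷ + 0 ℤ.+ b ∷ + 0 ∷ [])
      z+ y∈ = dilation-+ (InConv⇒InDilation z∈) (InConv⇒InDilation y∈)
      w≥0 = ℤP.+-mono-≤ (IsBit⇒nonNeg s₃-bit) (IsBit⇒nonNeg s-bit)
      row : ∀ {c} → IsBit c → InDilation V 2 (s₃ ℤ.+ s ∷ c ℤ.+ c ∷ + 0 ∷ [])
      row c-bit = dilation-+ (InConv⇒InDilation (floor s₃-bit c-bit)) (InConv⇒InDilation (floor s-bit c-bit))
      extra : ∀ b → InConv V (s ∷ b ∷ + 1 ∷ []) → ¬ IsBit b → b ≢ + 2 → BeyondStrip
      extra (+ 0) _ non-bit _ = ⊥-elim (non-bit (inj₁ refl))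
      extra (+ 1) _ non-bit _ = ⊥-elim (non-bit (inj₂ refl))
      extra (+ 2) _ _ b≢2 = ⊥-elim (b≢2 refl)
      extra (+ suc (suc (suc n))) y∈ _ _ =
        s₃ ℤ.+ s , w≥0 ,
        inj₁ (dilation-segment (s₃ ℤ.+ s ∷ + 0 ∷ + 0 ∷ []) 1F (row (inj₂ refl)) (z+ y∈)
                               (+≤+ (s≤s (s≤s z≤n))) (+≤+ (s≤s (s≤s (s≤s z≤n)))))
      extra -[1+ n ] y∈ _ _ =
        s₃ ℤ.+ s , w≥0 , inj₂ (dilation-segment (s₃ ℤ.+ s ∷ + 0 ∷ + 0 ∷ []) 1F (z+ y∈) (row (inj₁ refl)) (-≤- z≤n) -≤+)

  module _ (long : + 8 ℤ.≤ coord (v 0F) 0F) where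

    ¬lattice-2≤x<8 : ∀ {n y z} → 2 ℕ.≤ n → n ℕ.< 8 → ¬ InConv V (+ n ∷ y ∷ z ∷ [])
    ¬lattice-2≤x<8 {n} {y} {z} 2≤n n<8 p∈ = ℕP.<⇒≱ n<8 (ℤP.drop‿+≤+ (subst (+ 8 ℤ.≤_) (sym n≡a) long))
      where
        ≥2⇒non-bit : ∀ {n} → 2 ℕ.≤ n → ¬ IsBit (+ n)
        ≥2⇒non-bit (s≤s (s≤s _)) (inj₁ ())
        ≥2⇒non-bit (s≤s (s≤s _)) (inj₂ ())
        n≡a = non-bit-coordinate (+ n ∷ y ∷ z ∷ []) 0F p∈ (≥2⇒non-bit 2≤n)

    ¬flat-x-vertex : ∀ {s} → v 0F ≡ coord (v 0F) 0F ∷ s ∷ + 0 ∷ [] → IsBit s → ⊥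
    ¬flat-x-vertex {s} x-vertex s-bit = ¬lattice-2≤x<8 (s≤s (s≤s z≤n)) (s≤s (s≤s (s≤s z≤n))) $
      conv-segment (+ 0 ∷ s ∷ + 0 ∷ []) 0F (floor (inj₂ refl) s-bit) (subst (InConv V) x-vertex (vertex-in 0F))
                   (+≤+ (s≤s z≤n)) (ℤP.≤-trans (+≤+ (s≤s (s≤s z≤n))) long)

    -- (4, m/2, 0) lies between (0, m/2, 0) and the midpoint of the x- and z-vertex.
    far-floor-point : ∀ {m s₃} → v 0F ≡ coord (v 0F) 0F ∷ + m ∷ + 1 ∷ [] → v 2F ≡ s₃ ∷ + 0 ∷ -[1+ 0 ] ∷ [] →
                      IsBit (+ m) → IsBit s₃ → InDilation V 2 (+ 8 ∷ + m ∷ + 0 ∷ [])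
    far-floor-point {m} {s₃} x-vertex z-vertex m-bit s₃-bit =
      dilation-segment (+ 0 ∷ + m ∷ + 0 ∷ []) 0F
        (dilation-+ (dilated (floor (inj₁ refl) (inj₁ refl))) (dilated (floor (inj₁ refl) m-bit)))
        (dilation-+ (dilated (subst (InConv V) z-vertex (vertex-in 2F))) (dilated (subst (InConv V) x-vertex (vertex-in 0F))))
        (+≤+ z≤n) (ℤP.≤-trans long (ℤP.i≤j+i _ s₃ {{ℤ.nonNegative (IsBit⇒nonNeg s₃-bit)}}))
      where dilated = InConv⇒InDilation

    -- (2, c, 0) lies between (0, c, 0) and the midpoint of (4, 1/2, 0) and (w/2, y/2, 0),
    -- whose y-coordinate is (1 + y)/4 = c.
    ¬far-and-beyond-strip : ∀ {w y c} → InDilation V 2 (+ 8 ∷ + 1 ∷ + 0 ∷ []) → InDilation V 2 (w ∷ y ∷ + 0 ∷ []) →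
                            + 0 ℤ.≤ w → IsBit c → + 1 ℤ.+ y ≡ + 4 ℤ.* c → ⊥
    ¬far-and-beyond-strip {w} {y} {c} Q E w≥0 c-bit y≡4c-1 =
      ¬lattice-2≤x<8 (s≤s (s≤s z≤n)) (s≤s (s≤s (s≤s z≤n))) $
        InDilation⇒InConv $ dilation-divide {p = + 2 ∷ c ∷ + 0 ∷ []} 4 $
        dilation-segment (+ 0 ∷ + 4 ℤ.* c ∷ + 0 ∷ []) 0F base far (+≤+ z≤n) (ℤP.i≤i+j (+ 8) w {{ℤ.nonNegative w≥0}})
      where
        base : InDilation V 4 (+ 0 ∷ + 4 ℤ.* c ∷ + 0 ∷ [])
        base = dilation-scale 4 (InConv⇒InDilation (floor (inj₁ refl) c-bit))
        far : InDilation V 4 (+ 8 ℤ.+ w ∷ + 4 ℤ.* c ∷ + 0 ∷ [])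
        far = subst (λ t → InDilation V 4 (+ 8 ℤ.+ w ∷ t ∷ + 0 ∷ [])) y≡4c-1 (dilation-+ Q E)

    ¬long-x-vertex : ∀ {s₁ t₁ s₂ b t₂ s₃} →
      v 0F ≡ coord (v 0F) 0F ∷ s₁ ∷ t₁ ∷ [] → v 1F ≡ s₂ ∷ b ∷ t₂ ∷ [] → v 2F ≡ s₃ ∷ + 0 ∷ -[1+ 0 ] ∷ [] →
      IsBit s₁ → IsBit t₁ → IsBit s₂ → IsBit t₂ → IsBit s₃ → ¬ IsBit b → ⊥
    ¬long-x-vertex x-vertex _ _ s₁-bit (inj₁ refl) _ _ _ _ = ¬flat-x-vertex x-vertex s₁-bit
    ¬long-x-vertex x-vertex _ z-vertex (inj₁ refl) (inj₂ refl) _ _ s₃-bit _ =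
      ¬lattice-2≤x<8 (s≤s (s≤s z≤n)) (s≤s (s≤s (s≤s (s≤s (s≤s z≤n))))) $
        InDilation⇒InConv $ dilation-divide {p = + 4 ∷ + 0 ∷ + 0 ∷ []} 2 $
        far-floor-point x-vertex z-vertex (inj₁ refl) s₃-bit
    ¬long-x-vertex {s₂ = s₂} {b} x-vertex y-vertex z-vertex (inj₂ refl) (inj₂ refl) s₂-bit t₂-bit s₃-bit b-non-bit =
      beyond (y-vertex-beyond-strip t₂-bit y-vertex)
      where
        y-vertex-beyond-strip : ∀ {t₂} → IsBit t₂ → v 1F ≡ s₂ ∷ b ∷ t₂ ∷ [] → BeyondStrip
        y-vertex-beyond-strip (inj₁ refl) y-vertex = flat-y-vertex⇒beyond-strip y-vertex s₂-bit b-non-bit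
        y-vertex-beyond-strip (inj₂ refl) y-vertex =
          raised-y-vertex⇒beyond-strip y-vertex z-vertex s₂-bit s₃-bit b-non-bit
            λ { refl → z-y-slab-impossible x-vertex y-vertex z-vertex }
        Q = far-floor-point x-vertex z-vertex (inj₂ refl) s₃-bit
        beyond : BeyondStrip → ⊥
        beyond (w , w≥0 , inj₁ E) = ¬far-and-beyond-strip Q E w≥0 (inj₂ refl) refl
        beyond (w , w≥0 , inj₂ E) = ¬far-and-beyond-strip Q E w≥0 (inj₁ refl) refl

  x-vertex-≤7 : coord (v 2F) 1F ≡ + 0 → coord (v 0F) 0F ℤ.≤ + 7
  x-vertex-≤7 t₃≡0 with coord (v 0F) 0F ℤ.≤? + 7
  ... | yes a≤7 = a≤7
  ... | no a≰7 = ⊥-elim $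
    ¬long-x-vertex (ℤP.i<j⇒suc[i]≤j (ℤP.≰⇒> a≰7)) (point-η (v 0F)) (point-η (v 1F)) z-vertex
                   (off-diagonal-bit λ ()) (off-diagonal-bit λ ()) (off-diagonal-bit λ ()) (off-diagonal-bit λ ())
                   (off-diagonal-bit λ ()) (diagonal-non-bit 1F)
    where
      z-vertex : v 2F ≡ coord (v 2F) 0F ∷ + 0 ∷ -[1+ 0 ] ∷ []
      z-vertex = trans (point-η (v 2F)) (cong₂ (λ t a → coord (v 2F) 0F ∷ t ∷ a ∷ []) t₃≡0 z-vertex-height)

floor-x-vertex-≤7 : ∀ {V v} → Boxed V v → IsFacet V 2F (+ 0) → coord (v 0F) 0F ≤ + 7
floor-x-vertex-≤7 boxed facet with Floor.off-diagonal-bit boxed facet {1F} {2F} (λ ())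
... | inj₁ t₃≡0 = Floor.x-vertex-≤7 boxed facet t₃≡0
... | inj₂ t₃≡1 =
  Floor.x-vertex-≤7 (Boxed-act (reflection 1F) boxed) (IsFacet-act (reflection 1F) facet) (cong (reflect true) t₃≡1)

dval≤6 : ∀ {a} → a ≤ + 7 → reflect true a ≤ + 7 → dval a ≤ + 6
dval≤6 {a} a≤7 1-a≤7 = ℤP.⊔-lub (ℤP.+-monoˡ-≤ -[1+ 0 ] a≤7) (begin
  ℤ.- a                         ≡⟨ shift a ⟩
  reflect true a ℤ.+ -[1+ 0 ]   ≤⟨ ℤP.+-monoˡ-≤ -[1+ 0 ] 1-a≤7 ⟩
  + 6                           ∎)
  where
    open ℤP.≤-Reasoning
    shift : ∀ a → ℤ.- a ≡ (+ 1 ℤ.- a) ℤ.+ -[1+ 0 ]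
    shift = solve-∀

floor-x-vertex-bound : ∀ {V v} → Boxed V v → IsFacet V 2F (+ 0) → dval (coord (v 0F) 0F) ≤ + 6
floor-x-vertex-bound boxed facet =
  dval≤6 (floor-x-vertex-≤7 boxed facet)
         (floor-x-vertex-≤7 (Boxed-act (reflection 0F) boxed) (IsFacet-act (reflection 0F) facet))

floor-bound : ∀ {V v} → Boxed V v → IsFacet V 2F (+ 0) → DiagonalBounded v
floor-bound boxed facet 0F = floor-x-vertex-bound boxed facet
floor-bound boxed facet 1F =
  floor-x-vertex-bound (Boxed-act (transposition 0F 1F) boxed) (IsFacet-act (transposition 0F 1F) facet)
floor-bound boxed facet 2F = subst (λ a → dval a ≤ + 6) (sym (Floor.z-vertex-height boxed facet)) (+≤+ (s≤s z≤n))

horizontal-facet-bound : ∀ {V v b} → Boxed V v → IsBit b → IsFacet V 2F b → DiagonalBounded v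
horizontal-facet-bound boxed (inj₁ refl) facet = floor-bound boxed facet
horizontal-facet-bound {v = v} boxed (inj₂ refl) facet =
  DiagonalBounded-act⁻¹ (reflection 2F) {v}
    (floor-bound (Boxed-act (reflection 2F) boxed) (IsFacet-act (reflection 2F) facet))

lemma7 : (V : List Point) (v : Fin 3 → Point) →
    Boxed V v → FacetCond V →
    (i : Fin 3) → dval (coord (v i) i) ≤ + 6
lemma7 V v boxed (f , b , b-bit , facet) =
  DiagonalBounded-act⁻¹ σ {v} (horizontal-facet-bound (Boxed-act σ boxed) b-bit
                            (subst (λ g → IsFacet (map (act σ) V) g b) (transpose-to-z f) (IsFacet-act σ facet)))
  where
    σ = transposition f 2F
    transpose-to-z : ∀ f → Perm.transpose f 2F ⟨$⟩ˡ f ≡ 2F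
    transpose-to-z 0F = refl
    transpose-to-z 1F = refl
    transpose-to-z 2F = refl
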